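{- There exists a real number $\alpha>1.61226$ such that $\neg SD(0,1,2,\infty;\alpha)$ holds. That is, there exists a finite set $G\subset\mathbb{R}^2$ such that $\pi_{ -1}$ is injective on $G$ and $$\alpha=\frac{\log|G|}{\max\{\log|\pi_0(G)|,\ \log|\pi_1(G)|,\ \log|\pi_2(G)|,\ \log|\pi_\infty(G)|\}}.$$
   Context: For $r\in\mathbb{Q}\cup\{\infty\}$ define $\pi_r:\mathbb{R}^2\to\mathbb{R}$ by $\pi_r(a,b)=a+rb$, with the convention $\pi_\infty(a,b)=b$. For a finite set $A$, $|A|$ denotes its cardinality. For $r_1,\dots,r_n\in\mathbb{Q}\cup\{\infty\}\setminus\{ -1\}$ and a real number $\alpha$, the statement $\neg SD(r_1,\dots,r_n;\alpha)$ means: there exists a finite set $G\subset\mathbb{R}^2$ such that $\pi_{ -1}$ (i.e. $(a,b)\mapsto a-b$) is injective on $G$ and $\alpha=\frac{\log|G|}{\max_j \log|\pi_{r_j}(G)|}$. -}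

module Defs where

open import Data.Rational using (ℚ; _+_; _*_; -_; 1ℚ)
open import Data.Rational.Properties using (_≟_)
open import Data.Nat using (ℕ; _⊔_)
open import Data.Product using (_×_; _,_)
open import Data.List using (List; length; map; deduplicate)
open import Data.List.Membership.Propositional using (_∈_)
open import Relation.Binary.PropositionalEquality using (_≡_)

data Dir : Set where
  fin : ℚ → Dir
  ∞   : Dir

π : Dir → ℚ × ℚ → ℚ
π (fin r) (a , b) = a + r * b
π ∞       (a , b) = b

imageCard : {A : Set} → (A → ℚ) → List A → ℕ
imageCard f G = length (deduplicate _≟_ (map f G))

projCard : Dir → List (ℚ × ℚ) → ℕ
projCard r G = imageCard (π r) G

InjectiveOn : {A B : Set} → (A → B) → List A → Set
InjectiveOn f G = ∀ {x y} → x ∈ G → y ∈ G → f x ≡ f y → x ≡ y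

maxProj0-1-2-∞ : List (ℚ × ℚ) → ℕ
maxProj0-1-2-∞ G =
  projCard (fin (Data.Rational.0ℚ)) G ⊔ projCard (fin 1ℚ) G
    ⊔ projCard (fin (1ℚ + 1ℚ)) G ⊔ projCard ∞ G

-- Let u₀,…,u₆ be the seven points (aₛ, bₛ) below, whose differences aₛ − bₛ are distinct, and
-- let G consist of the points Σᵢ 16ⁱ u_{wᵢ} for the words w of length 200 in which the letter s
-- occurs cₛ times. All digits involved are below 16, so π₋₁ of such a point, Σᵢ 16ⁱ (a − b)_{wᵢ},
-- determines w; hence π₋₁ is injective on G and |G| is the multinomial coefficient 200!/∏ cₛ!,
-- which is at least 2⁴⁷³. For r ∈ {0, 1, 2, ∞} the value π_r(Σᵢ 16ⁱ u_{wᵢ}) only depends on the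
-- word of digits π_r(u_{wᵢ}), whose letter counts are the pushforward of c along s ↦ π_r(uₛ);
-- so |π_r(G)| is at most the corresponding multinomial coefficient, which is at most 2²⁹².
-- Finally 473 / 292 > 1.61226.

module Submission where

open import Algebra.Bundles using (CommutativeMonoid)
open import Data.Bool using (if_then_else_)
open import Data.Fin using (Fin; zero; suc; punchIn; toℕ)
open import Data.Fin.Properties using (_≟_; punchInᵢ≢i; all?; toℕ-fromℕ<)
import Data.Integer as ℤ
import Data.Integer.Properties as ℤ
open import Data.Integer.Solver using (module +-*-Solver)
open import Data.List
  using (List; []; _∷_; [_]; _++_; length; map; concat; concatMap; deduplicate; allFin; tabulate)
open import Data.List.Properties using (length-map; length-++; map-cong; map-∘)
open import Data.List.Membership.Propositional using (_∈_; lose)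
open import Data.List.Membership.Propositional.Properties
  using (∈-map⁺; ∈-map⁻; ∈-concatMap⁺; ∈-concatMap⁻; ∈-allFin; ∈-∃++; ∈-++⁻; ∈-++⁺ˡ; ∈-++⁺ʳ;
         ∈-deduplicate⁺; ∈-deduplicate⁻)
import Data.List.Relation.Unary.All as All
import Data.List.Relation.Unary.All.Properties as All
import Data.List.Relation.Unary.AllPairs as AllPairs
import Data.List.Relation.Unary.AllPairs.Properties as AllPairs
open import Data.List.Relation.Unary.Any using (here; there; satisfied)
open import Data.List.Relation.Unary.Unique.Propositional using (Unique; []; _∷_)
import Data.List.Relation.Unary.Unique.Propositional.Properties as Unique
open import Data.List.Relation.Unary.Unique.DecPropositional.Properties using (deduplicate-!)
open import Data.Nat
  using (ℕ; zero; suc; pred; _+_; _*_; _∸_; _^_; _!; _≤_; _<_; _≤?_; _<?_; z≤n; s≤s; NonZero)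
  renaming (_≟_ to _≟ℕ_)
open import Data.Nat.DivMod using (_%_; _mod_; m%n<n; m<n⇒m%n≡m; [m+kn]%n≡m%n)
open import Data.Nat.Properties
  using (+-0-commutativeMonoid; *-1-commutativeMonoid; +-*-semiring; +-commutativeSemigroup;
         *-commutativeSemigroup; +-identityʳ; +-suc; *-zeroʳ; *-assoc; *-distribˡ-+; *-distribʳ-+;
         +-cancelˡ-≡; *-cancelʳ-≡; *-cancelʳ-≤; suc-injective; m+n≡0⇒m≡0; m+n≡0⇒n≡0; m∸n+n≡m;
         m*n≢0; _!≢0; ≤-trans; ≤-reflexive; ≰⇒>; m≤n⇒m≤n⊔o; m≤n⇒m≤o⊔n; ⊔-lub;
         ^-monoˡ-≤; ^-monoʳ-≤; ^-monoʳ-<; ^-*-assoc; module ≤-Reasoning)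
open import Data.Product using (Σ; ∃; _×_; _,_)
open import Data.Rational using (ℚ; 0ℚ; 1ℚ; -_)
import Data.Rational as ℚ
import Data.Rational.Properties as ℚ
open import Data.Rational.Literals using (fromℤ)
import Data.Rational.Unnormalised as ℚᵘ
import Data.Rational.Unnormalised.Properties as ℚᵘ
open import Data.Sum using (inj₁; inj₂)
open import Data.Vec using (Vec; []; _∷_; lookup)
import Data.Vec as Vec
open import Data.Vec.Properties using (∷-injectiveʳ)
open import Data.Vec.Functional using (Vector; removeAt; updateAt)
open import Data.Vec.Functional.Properties using (updateAt-updates; updateAt-minimal)
open import Function using (_∘_)
open import Relation.Nullary using (¬_; does; yes; no; contradiction; _→-dec_)
open import Relation.Nullary.Decidable using (From-yes; from-yes)
open import Relation.Binary.PropositionalEquality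
  using (_≡_; _≢_; _≗_; refl; sym; trans; cong; cong₂; subst; module ≡-Reasoning)

open import Algebra.Properties.CommutativeSemigroup +-commutativeSemigroup using (interchange)
open import Algebra.Properties.CommutativeSemigroup *-commutativeSemigroup using (x∙yz≈y∙xz)

open import Defs

module _ {c ℓ} (M : CommutativeMonoid c ℓ) where
  open CommutativeMonoid M using (Carrier; _≈_; _∙_; ∙-congˡ; ∙-congʳ; assoc; setoid)
  open import Algebra.Properties.CommutativeMonoid.Sum M using (sum; sum-remove; sum-cong-≋)
  open import Relation.Binary.Reasoning.Setoid setoid

  sum-agreeing-except : ∀ {n} (i : Fin n) {t u : Vector Carrier n} x →
                        (∀ j → j ≢ i → t j ≈ u j) → t i ≈ x ∙ u i → sum t ≈ x ∙ sum u
  sum-agreeing-except {suc _} i {t} {u} x agree ti≈x∙ui = begin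
    sum t                          ≈⟨ sum-remove t ⟩
    t i ∙ sum (removeAt t i)       ≈⟨ ∙-congˡ (sum-cong-≋ λ j → agree (punchIn i j) (punchInᵢ≢i i j)) ⟩
    t i ∙ sum (removeAt u i)       ≈⟨ ∙-congʳ ti≈x∙ui ⟩
    (x ∙ u i) ∙ sum (removeAt u i) ≈⟨ assoc x (u i) _ ⟩
    x ∙ (u i ∙ sum (removeAt u i)) ≈⟨ ∙-congˡ (sum-remove u) ⟨
    x ∙ sum u                      ∎

open import Algebra.Properties.Semiring.Sum +-*-semiring
  using (sum; sum-cong-≗; sum-replicate-zero; *-distribʳ-sum; ∑-comm)
open import Algebra.Properties.CommutativeMonoid.Sum *-1-commutativeMonoid
  using () renaming (sum to product)

pointMass : ∀ {j} → Fin j → ℕ → Vector ℕ j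
pointMass x m t = if does (x ≟ t) then m else 0

pointMass-same : ∀ {j} (x : Fin j) m → pointMass x m x ≡ m
pointMass-same x m with x ≟ x
... | yes _  = refl
... | no x≢x = contradiction refl x≢x

pointMass-other : ∀ {j} {x t : Fin j} m → x ≢ t → pointMass x m t ≡ 0
pointMass-other {x = x} {t} m x≢t with x ≟ t
... | yes x≡t = contradiction x≡t x≢t
... | no _    = refl

sum-pointMass : ∀ {j} (x : Fin j) m → sum (pointMass x m) ≡ m
sum-pointMass {j} x m = begin
  sum (pointMass x m)    ≡⟨ sum-agreeing-except +-0-commutativeMonoid x m elsewhere
                              (trans (pointMass-same x m) (sym (+-identityʳ m))) ⟩
  m + sum {j} (λ _ → 0)  ≡⟨ cong (m +_) (sum-replicate-zero j) ⟩
  m + 0                  ≡⟨ +-identityʳ m ⟩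
  m                      ∎
  where
  open ≡-Reasoning
  elsewhere : ∀ t → t ≢ x → pointMass x m t ≡ 0
  elsewhere t t≢x = pointMass-other m (t≢x ∘ sym)

Content : ℕ → Set
Content k = Vector ℕ k

decrement : ∀ {k} → Fin k → Content k → Content k
decrement s c = updateAt c s pred

decrement-same : ∀ {k} {s : Fin k} (c : Content k) {m} → c s ≡ suc m → decrement s c s ≡ m
decrement-same {s = s} c cs≡1+m = trans (updateAt-updates s c) (cong pred cs≡1+m)

decrement-other : ∀ {k} (s : Fin k) (c : Content k) t → t ≢ s → c t ≡ decrement s c t
decrement-other s c t t≢s = sym (updateAt-minimal t s c t≢s)

decrement-cong : ∀ {k} (s : Fin k) {c c′ : Content k} → c ≗ c′ → decrement s c ≗ decrement s c′
decrement-cong s {c} {c′} c≗c′ t with t ≟ s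
... | yes refl =
  trans (updateAt-updates s c) (trans (cong pred (c≗c′ s)) (sym (updateAt-updates s c′)))
... | no t≢s   =
  trans (updateAt-minimal t s c t≢s) (trans (c≗c′ t) (sym (updateAt-minimal t s c′ t≢s)))

sum-decrement : ∀ {k} {s : Fin k} (c : Content k) {m} → c s ≡ suc m → sum c ≡ suc (sum (decrement s c))
sum-decrement {s = s} c cs≡1+m = sum-agreeing-except +-0-commutativeMonoid s 1 (decrement-other s c)
  (trans cs≡1+m (cong suc (sym (decrement-same c cs≡1+m))))

∏! : ∀ {k} → Content k → ℕ
∏! c = product (λ s → c s !)

∏!-nonZero : ∀ {k} (c : Content k) → NonZero (∏! c)
∏!-nonZero {zero}  c = _
∏!-nonZero {suc k} c = m*n≢0 (c zero !) (∏! (c ∘ suc)) {{c zero !≢0}} {{∏!-nonZero (c ∘ suc)}}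

∏!-empty : ∀ {k} (c : Content k) → sum c ≡ 0 → ∏! c ≡ 1
∏!-empty {zero}  c _     = refl
∏!-empty {suc k} c sum≡0 = cong₂ (λ x y → x ! * y)
  (m+n≡0⇒m≡0 (c zero) sum≡0) (∏!-empty (c ∘ suc) (m+n≡0⇒n≡0 (c zero) sum≡0))

∏!-decrement : ∀ {k} {s : Fin k} (c : Content k) {m} → c s ≡ suc m → ∏! c ≡ suc m * ∏! (decrement s c)
∏!-decrement {s = s} c {m} cs≡1+m = sum-agreeing-except *-1-commutativeMonoid s (suc m)
  (λ t → cong _! ∘ decrement-other s c t)
  (trans (cong _! cs≡1+m) (cong (λ x → suc m * x !) (sym (decrement-same c cs≡1+m))))

pushforward : ∀ {k j} → (Fin k → Fin j) → Content k → Content j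
pushforward f c t = sum (λ s → pointMass (f s) (c s) t)

sum-pushforward : ∀ {k j} (f : Fin k → Fin j) (c : Content k) → sum (pushforward f c) ≡ sum c
sum-pushforward f c =
  trans (∑-comm (λ t s → pointMass (f s) (c s) t)) (sum-cong-≗ λ s → sum-pointMass (f s) (c s))

pushforward-decrement-same : ∀ {k j} (f : Fin k → Fin j) {s} (c : Content k) {m} → c s ≡ suc m →
                             pushforward f c (f s) ≡ suc (pushforward f (decrement s c) (f s))
pushforward-decrement-same f {s} c cs≡1+m = sum-agreeing-except +-0-commutativeMonoid s 1
  (λ t t≢s → cong (λ x → pointMass (f t) x (f s)) (decrement-other s c t t≢s))
  (begin
    pointMass (f s) (c s) (f s)                ≡⟨ pointMass-same (f s) (c s) ⟩
    c s                                        ≡⟨ cs≡1+m ⟩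
    suc _                                      ≡⟨ cong suc (decrement-same c cs≡1+m) ⟨
    suc (decrement s c s)                      ≡⟨ cong suc (pointMass-same (f s) (decrement s c s)) ⟨
    suc (pointMass (f s) (decrement s c s) (f s)) ∎)
  where open ≡-Reasoning

pushforward-decrement : ∀ {k j} (f : Fin k → Fin j) {s} (c : Content k) {m} → c s ≡ suc m →
                        pushforward f (decrement s c) ≗ decrement (f s) (pushforward f c)
pushforward-decrement f {s} c cs≡1+m t with t ≟ f s
... | yes refl = sym (trans (updateAt-updates (f s) (pushforward f c))
                            (cong pred (pushforward-decrement-same f c cs≡1+m)))
... | no t≢fs  = trans (sum-cong-≗ unchanged) (sym (updateAt-minimal t (f s) (pushforward f c) t≢fs))
  where
  unchanged : ∀ s′ → pointMass (f s′) (decrement s c s′) t ≡ pointMass (f s′) (c s′) t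
  unchanged s′ with s′ ≟ s
  ... | yes refl = trans (pointMass-other _ (t≢fs ∘ sym)) (sym (pointMass-other _ (t≢fs ∘ sym)))
  ... | no s′≢s  = cong (λ x → pointMass (f s′) x t) (sym (decrement-other s c s′ s′≢s))

consIfPositive : ∀ {A : Set} {n} → A → ℕ → List (Vec A n) → List (Vec A (suc n))
consIfPositive s zero    ws = []
consIfPositive s (suc _) ws = map (s ∷_) ws

mutual
  words : ∀ {k} n → Content k → List (Vec (Fin k) n)
  words zero    c = [ [] ]
  words (suc n) c = concatMap (wordsStartingWith n c) (allFin _)

  wordsStartingWith : ∀ {k} n → Content k → Fin k → List (Vec (Fin k) (suc n))
  wordsStartingWith n c s = consIfPositive s (c s) (words n (decrement s c))

module _ {A : Set} {n : ℕ} (s : A) where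

  ∈-consIfPositive⁻ : ∀ m (ws : List (Vec A n)) {t w} → t ∷ w ∈ consIfPositive s m ws →
                      t ≡ s × (∃ λ m′ → m ≡ suc m′) × w ∈ ws
  ∈-consIfPositive⁻ (suc m) ws t∷w∈ with ∈-map⁻ (s ∷_) t∷w∈
  ... | _ , w∈ws , refl = refl , (m , refl) , w∈ws

  consIfPositive-unique : ∀ m {ws : List (Vec A n)} → Unique ws → Unique (consIfPositive s m ws)
  consIfPositive-unique zero    _   = []
  consIfPositive-unique (suc _) ws! = Unique.map⁺ ∷-injectiveʳ ws!

module _ {k n : ℕ} {c : Content k} where

  ∈-wordsStartingWith⁻ : ∀ s {t} {w : Vec (Fin k) n} → t ∷ w ∈ wordsStartingWith n c s →
                         t ≡ s × (∃ λ m → c s ≡ suc m) × w ∈ words n (decrement s c)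
  ∈-wordsStartingWith⁻ s = ∈-consIfPositive⁻ s (c s) (words n (decrement s c))

  ∈-words-∷⁺ : ∀ {s m} {w : Vec (Fin k) n} → c s ≡ suc m → w ∈ words n (decrement s c) →
               s ∷ w ∈ words (suc n) c
  ∈-words-∷⁺ {s} {w = w} cs≡1+m w∈ = ∈-concatMap⁺ (wordsStartingWith n c) (lose (∈-allFin s)
    (subst (λ m → s ∷ w ∈ consIfPositive s m (words n (decrement s c))) (sym cs≡1+m)
      (∈-map⁺ (s ∷_) w∈)))

  ∈-words-∷⁻ : ∀ {t} {w : Vec (Fin k) n} → t ∷ w ∈ words (suc n) c →
               (∃ λ m → c t ≡ suc m) × w ∈ words n (decrement t c)
  ∈-words-∷⁻ t∷w∈ with satisfied (∈-concatMap⁻ (wordsStartingWith n c) {xs = allFin k} t∷w∈)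
  ... | s , t∷w∈′ with ∈-wordsStartingWith⁻ s t∷w∈′
  ... | refl , positive , w∈ = positive , w∈

words-cong : ∀ {k} n {c c′ : Content k} → c ≗ c′ → words n c ≡ words n c′
words-cong zero    c≗c′ = refl
words-cong (suc n) c≗c′ = cong concat (map-cong (λ s →
  cong₂ (consIfPositive s) (c≗c′ s) (words-cong n (decrement-cong s c≗c′))) (allFin _))

words-unique : ∀ {k} n (c : Content k) → Unique (words n c)
words-unique zero    c = All.[] ∷ []
words-unique {k} (suc n) c = Unique.concat⁺
  (All.map⁺ (All.tabulate λ {s} _ →
    consIfPositive-unique s (c s) (words-unique n (decrement s c))))
  (AllPairs.map⁺ (AllPairs.map disjoint (Unique.allFin⁺ k)))
  where
  disjoint : ∀ {s s′} → s ≢ s′ → ∀ {v} → ¬ (v ∈ wordsStartingWith n c s × v ∈ wordsStartingWith n c s′)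
  disjoint {s} {s′} s≢s′ {_ ∷ _} (v∈ , v∈′)
    with ∈-wordsStartingWith⁻ {c = c} s v∈ | ∈-wordsStartingWith⁻ {c = c} s′ v∈′
  ... | refl , _ | refl , _ = s≢s′ refl

length-concatMap-allFin : ∀ {A : Set} {k} (B : Fin k → List A) →
                          length (concatMap B (allFin k)) ≡ sum (length ∘ B)
length-concatMap-allFin B = go B (λ s → s)
  where
  go : ∀ {A : Set} {k m} (B : Fin m → List A) (h : Fin k → Fin m) →
       length (concatMap B (tabulate h)) ≡ sum (length ∘ B ∘ h)
  go {k = zero}  B h = refl
  go {k = suc k} B h = trans (length-++ (B (h zero))) (cong (length (B (h zero)) +_) (go B (h ∘ suc)))

length-words : ∀ {k} n (c : Content k) → sum c ≡ n → length (words n c) * ∏! c ≡ n !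
length-words zero    c sum≡0   = cong (1 *_) (∏!-empty c sum≡0)
length-words (suc n) c sum≡1+n = begin
  length (words (suc n) c) * ∏! c
    ≡⟨ cong (_* ∏! c) (length-concatMap-allFin (wordsStartingWith n c)) ⟩
  sum (length ∘ wordsStartingWith n c) * ∏! c
    ≡⟨ *-distribʳ-sum (∏! c) (length ∘ wordsStartingWith n c) ⟩
  sum (λ s → length (wordsStartingWith n c s) * ∏! c)
    ≡⟨ sum-cong-≗ (λ s → startingWith s (c s) refl) ⟩
  sum (λ s → c s * n !)
    ≡⟨ *-distribʳ-sum (n !) c ⟨
  sum c * n !
    ≡⟨ cong (_* n !) sum≡1+n ⟩
  suc n !
    ∎
  where
  open ≡-Reasoning
  startingWith : ∀ s m → c s ≡ m →
                 length (consIfPositive s m (words n (decrement s c))) * ∏! c ≡ m * n !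
  startingWith s zero    _      = refl
  startingWith s (suc m) cs≡1+m = begin
    length (map (s ∷_) (words n c′)) * ∏! c
      ≡⟨ cong₂ _*_ (length-map (s ∷_) (words n c′)) (∏!-decrement c cs≡1+m) ⟩
    length (words n c′) * (suc m * ∏! c′)
      ≡⟨ x∙yz≈y∙xz (length (words n c′)) (suc m) (∏! c′) ⟩
    suc m * (length (words n c′) * ∏! c′)
      ≡⟨ cong (suc m *_) (length-words n c′ sum-c′) ⟩
    suc m * n !
      ∎
    where
    c′ = decrement s c
    sum-c′ : sum c′ ≡ n
    sum-c′ = suc-injective (trans (sym (sum-decrement c cs≡1+m)) sum≡1+n)

module _ {k : ℕ} (n : ℕ) (c : Content k) (sum≡n : sum c ≡ n) where

  length-words-≥ : ∀ {B} → B * ∏! c ≤ n ! → B ≤ length (words n c)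
  length-words-≥ {B} B*∏!≤n! = *-cancelʳ-≤ B _ (∏! c) {{∏!-nonZero c}}
    (≤-trans B*∏!≤n! (≤-reflexive (sym (length-words n c sum≡n))))

  length-words-≤ : ∀ {B} → n ! ≤ B * ∏! c → length (words n c) ≤ B
  length-words-≤ {B} n!≤B*∏! = *-cancelʳ-≤ _ B (∏! c) {{∏!-nonZero c}}
    (≤-trans (≤-reflexive (length-words n c sum≡n)) n!≤B*∏!)

map-∈-words : ∀ {k j} (f : Fin k → Fin j) n {c : Content k} {w} → w ∈ words n c →
              Vec.map f w ∈ words n (pushforward f c)
map-∈-words f zero    {w = []}    _    = here refl
map-∈-words f (suc n) {c} {s ∷ w} s∷w∈ with ∈-words-∷⁻ s∷w∈
... | (_ , cs≡1+m) , w∈ = ∈-words-∷⁺ (pushforward-decrement-same f c cs≡1+m)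
  (subst (Vec.map f w ∈_) (words-cong n (pushforward-decrement f c cs≡1+m)) (map-∈-words f n w∈))

length-≤-of-Unique-⊆ : ∀ {A : Set} {xs ys : List A} → Unique xs → (∀ {x} → x ∈ xs → x ∈ ys) →
                       length xs ≤ length ys
length-≤-of-Unique-⊆ {xs = []}     _            _     = z≤n
length-≤-of-Unique-⊆ {xs = x ∷ xs} (x∉xs ∷ xs!) xs⊆ys with ∈-∃++ (xs⊆ys (here refl))
... | ys₁ , ys₂ , refl = begin
  suc (length xs)               ≤⟨ s≤s (length-≤-of-Unique-⊆ xs! xs⊆ys₁++ys₂) ⟩
  suc (length (ys₁ ++ ys₂))     ≡⟨ cong suc (length-++ ys₁) ⟩
  suc (length ys₁ + length ys₂) ≡⟨ +-suc (length ys₁) (length ys₂) ⟨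
  length ys₁ + suc (length ys₂) ≡⟨ length-++ ys₁ ⟨
  length (ys₁ ++ x ∷ ys₂)       ∎
  where
  open ≤-Reasoning
  xs⊆ys₁++ys₂ : ∀ {y} → y ∈ xs → y ∈ ys₁ ++ ys₂
  xs⊆ys₁++ys₂ y∈xs with ∈-++⁻ ys₁ (xs⊆ys (there y∈xs))
  ... | inj₁ y∈ys₁         = ∈-++⁺ˡ y∈ys₁
  ... | inj₂ (here refl)   = contradiction refl (All.lookup x∉xs y∈xs)
  ... | inj₂ (there y∈ys₂) = ∈-++⁺ʳ ys₁ y∈ys₂

imageCard-≤ : ∀ {A : Set} (f : A → ℚ) {xs : List A} {ys : List ℚ} →
              (∀ {x} → x ∈ xs → f x ∈ ys) → imageCard f xs ≤ length ys
imageCard-≤ f {xs} {ys} f[xs]⊆ys = length-≤-of-Unique-⊆ (deduplicate-! ℚ._≟_ (map f xs)) image⊆ys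
  where
  image⊆ys : ∀ {y} → y ∈ deduplicate ℚ._≟_ (map f xs) → y ∈ ys
  image⊆ys y∈ with ∈-map⁻ f (∈-deduplicate⁻ ℚ._≟_ (map f xs) y∈)
  ... | _ , x∈xs , refl = f[xs]⊆ys x∈xs

imageCard<2⇒constant : ∀ {A : Set} (f : A → ℚ) {xs : List A} {x y} →
                       imageCard f xs < 2 → x ∈ xs → y ∈ xs → f x ≡ f y
imageCard<2⇒constant f card<2 x∈xs y∈xs =
  atMostOne card<2 (∈-deduplicate⁺ ℚ._≟_ (∈-map⁺ f x∈xs)) (∈-deduplicate⁺ ℚ._≟_ (∈-map⁺ f y∈xs))
  where
  atMostOne : ∀ {ys : List ℚ} {p q} → length ys < 2 → p ∈ ys → q ∈ ys → p ≡ q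
  atMostOne {_ ∷ []}    _              (here refl) (here refl) = refl
  atMostOne {_ ∷ _ ∷ _} (s≤s (s≤s ())) _           _

imageCard-map : ∀ {A B : Set} (f : B → ℚ) (g : A → B) (xs : List A) →
                imageCard f (map g xs) ≡ imageCard (f ∘ g) xs
imageCard-map f g xs = cong (length ∘ deduplicate ℚ._≟_) (sym (map-∘ xs))

imageCard-cong : ∀ {A : Set} {f g : A → ℚ} → f ≗ g → (xs : List A) → imageCard f xs ≡ imageCard g xs
imageCard-cong f≗g xs = cong (length ∘ deduplicate ℚ._≟_) (map-cong f≗g xs)

π-0 : ∀ x y → π (fin 0ℚ) (x , y) ≡ x
π-0 x y = trans (cong (x ℚ.+_) (ℚ.*-zeroˡ y)) (ℚ.+-identityʳ x)

2≤maxProj : ∀ {G} → Unique G → 2 ≤ length G → 2 ≤ maxProj0-1-2-∞ G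
2≤maxProj {G} G! 2≤|G| with 2 ≤? projCard (fin 0ℚ) G | 2 ≤? projCard ∞ G
... | yes 2≤p₀ | _        = m≤n⇒m≤n⊔o _ (m≤n⇒m≤n⊔o _ (m≤n⇒m≤n⊔o _ 2≤p₀))
... | no _     | yes 2≤p∞ = m≤n⇒m≤o⊔n _ 2≤p∞
... | no p₀≱2  | no p∞≱2  = contradiction (G! , 2≤|G| , ≰⇒> p₀≱2 , ≰⇒> p∞≱2) (twoPointsDiffer G)
  where
  twoPointsDiffer : ∀ G → ¬ (Unique G × 2 ≤ length G × projCard (fin 0ℚ) G < 2 × projCard ∞ G < 2)
  twoPointsDiffer (_ ∷ []) (_ , s≤s () , _)
  twoPointsDiffer G@((x , y) ∷ (x′ , y′) ∷ _) ((p≢p′ ∷ _) , _ , p₀<2 , p∞<2) =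
    All.head p≢p′ (cong₂ _,_ x≡x′ y≡y′)
    where
    p∈G : (x , y) ∈ G
    p∈G = here refl
    p′∈G : (x′ , y′) ∈ G
    p′∈G = there (here refl)
    x≡x′ : x ≡ x′
    x≡x′ = trans (sym (π-0 x y)) (trans (imageCard<2⇒constant (π (fin 0ℚ)) p₀<2 p∈G p′∈G) (π-0 x′ y′))
    y≡y′ : y ≡ y′
    y≡y′ = imageCard<2⇒constant (π ∞) p∞<2 p∈G p′∈G

^-<-via-powers-of-2 : ∀ {M N p q a b} → M ≤ 2 ^ p → 2 ^ q ≤ N → p * a < q * b → M ^ a < N ^ b
^-<-via-powers-of-2 {M} {N} {p} {q} {a} {b} M≤2^p 2^q≤N pa<qb = begin-strict
  M ^ a       ≤⟨ ^-monoˡ-≤ a M≤2^p ⟩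
  (2 ^ p) ^ a ≡⟨ ^-*-assoc 2 p a ⟩
  2 ^ (p * a) <⟨ ^-monoʳ-< 2 (s≤s (s≤s z≤n)) pa<qb ⟩
  2 ^ (q * b) ≡⟨ ^-*-assoc 2 q b ⟨
  (2 ^ q) ^ b ≤⟨ ^-monoˡ-≤ b 2^q≤N ⟩
  N ^ b       ∎
  where open ≤-Reasoning

module _ (base : ℕ) {j : ℕ} where

  baseValue : ∀ {n} → (Fin j → ℕ) → Vec (Fin j) n → ℕ
  baseValue v []      = 0
  baseValue v (t ∷ w) = v t + baseValue v w * base

  baseValue-cong : ∀ {n} {u v : Fin j → ℕ} → u ≗ v → (w : Vec (Fin j) n) → baseValue u w ≡ baseValue v w
  baseValue-cong u≗v []      = refl
  baseValue-cong u≗v (t ∷ w) = cong₂ (λ x y → x + y * base) (u≗v t) (baseValue-cong u≗v w)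

  baseValue-+ : ∀ {n} (u v : Fin j → ℕ) (w : Vec (Fin j) n) →
                baseValue (λ s → u s + v s) w ≡ baseValue u w + baseValue v w
  baseValue-+ u v []      = refl
  baseValue-+ u v (t ∷ w) = begin
    (u t + v t) + baseValue (λ s → u s + v s) w * base ≡⟨ cong (λ x → (u t + v t) + x * base) IH ⟩
    (u t + v t) + (U + V) * base                       ≡⟨ cong ((u t + v t) +_) (*-distribʳ-+ base U V) ⟩
    (u t + v t) + (U * base + V * base)                ≡⟨ interchange (u t) (v t) (U * base) (V * base) ⟩
    (u t + U * base) + (v t + V * base)                ∎
    where
    open ≡-Reasoning
    U = baseValue u w
    V = baseValue v w
    IH = baseValue-+ u v w

  baseValue-*ˡ : ∀ {n} m (v : Fin j → ℕ) (w : Vec (Fin j) n) →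
                 baseValue (λ s → m * v s) w ≡ m * baseValue v w
  baseValue-*ˡ m v []      = sym (*-zeroʳ m)
  baseValue-*ˡ m v (t ∷ w) = begin
    m * v t + baseValue (λ s → m * v s) w * base ≡⟨ cong (λ x → m * v t + x * base) IH ⟩
    m * v t + m * V * base                       ≡⟨ cong (m * v t +_) (*-assoc m V base) ⟩
    m * v t + m * (V * base)                     ≡⟨ *-distribˡ-+ m (v t) (V * base) ⟨
    m * (v t + V * base)                         ∎
    where
    open ≡-Reasoning
    V = baseValue v w
    IH = baseValue-*ˡ m v w

baseValue-map : ∀ base {i j n} (v : Fin j → ℕ) (f : Fin i → Fin j) (w : Vec (Fin i) n) →
                baseValue base v (Vec.map f w) ≡ baseValue base (v ∘ f) w
baseValue-map base v f []      = refl
baseValue-map base v f (t ∷ w) = cong (λ x → v (f t) + x * base) (baseValue-map base v f w)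

divMod-unique : ∀ b .{{_ : NonZero b}} {d d′ x x′} → d < b → d′ < b →
                d + x * b ≡ d′ + x′ * b → d ≡ d′ × x ≡ x′
divMod-unique b {d} {d′} {x} {x′} d<b d′<b eq =
  d≡d′ , *-cancelʳ-≡ x x′ b (+-cancelˡ-≡ d _ _ (trans eq (cong (_+ x′ * b) (sym d≡d′))))
  where
  open ≡-Reasoning
  d≡d′ : d ≡ d′
  d≡d′ = begin
    d                 ≡⟨ m<n⇒m%n≡m d<b ⟨
    d % b             ≡⟨ [m+kn]%n≡m%n d x b ⟨
    (d + x * b) % b   ≡⟨ cong (_% b) eq ⟩
    (d′ + x′ * b) % b ≡⟨ [m+kn]%n≡m%n d′ x′ b ⟩
    d′ % b            ≡⟨ m<n⇒m%n≡m d′<b ⟩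
    d′                ∎

baseValue-injective : ∀ base .{{_ : NonZero base}} {j n} (v : Fin j → ℕ) → (∀ s → v s < base) →
                      (∀ {s s′} → v s ≡ v s′ → s ≡ s′) → (w w′ : Vec (Fin j) n) →
                      baseValue base v w ≡ baseValue base v w′ → w ≡ w′
baseValue-injective base v v<base v-inj []      []        _  = refl
baseValue-injective base v v<base v-inj (t ∷ w) (t′ ∷ w′) eq
  with divMod-unique base (v<base t) (v<base t′) eq
... | vt≡vt′ , rest≡ = cong₂ _∷_ (v-inj vt≡vt′) (baseValue-injective base v v<base v-inj w w′ rest≡)

fromℤ-+ : ∀ x y → fromℤ (x ℤ.+ y) ≡ fromℤ x ℚ.+ fromℤ y
fromℤ-+ x y = ℚ.toℚᵘ-injective (ℚᵘ.≃-sym (ℚᵘ.≃-trans (ℚ.toℚᵘ-homo-+ (fromℤ x) (fromℤ y))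
  (ℚᵘ.*≡* (cong (ℤ._* ℤ.1ℤ) (cong₂ ℤ._+_ (ℤ.*-identityʳ x) (ℤ.*-identityʳ y))))))

fromℤ-* : ∀ x y → fromℤ (x ℤ.* y) ≡ fromℤ x ℚ.* fromℤ y
fromℤ-* x y = ℚ.toℚᵘ-injective (ℚᵘ.≃-sym (ℚ.toℚᵘ-homo-* (fromℤ x) (fromℤ y)))

π-fromℤ : ∀ r x y → π (fin (fromℤ r)) (fromℤ x , fromℤ y) ≡ fromℤ (x ℤ.+ r ℤ.* y)
π-fromℤ r x y = sym (trans (fromℤ-+ x (r ℤ.* y)) (cong (fromℤ x ℚ.+_) (fromℤ-* r y)))

ι : ℕ → ℚ
ι n = fromℤ (ℤ.+ n)

ι-injective : ∀ {m n} → ι m ≡ ι n → m ≡ n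
ι-injective eq = ℤ.+-injective (cong ℚ.↥_ eq)

π-ι : ∀ m x y → π (fin (ι m)) (ι x , ι y) ≡ ι (x + m * y)
π-ι m x y = trans (π-fromℤ (ℤ.+ m) (ℤ.+ x) (ℤ.+ y))
  (cong fromℤ (trans (cong (ℤ._+_ (ℤ.+ x)) (sym (ℤ.pos-* m y))) (sym (ℤ.pos-+ x (m * y)))))

π-1-ι : ∀ x y → π (fin (- 1ℚ)) (ι (x + y) , ι y) ≡ ι x
π-1-ι x y = trans (π-fromℤ ℤ.-1ℤ (ℤ.+ (x + y)) Y) (cong fromℤ (begin
  ℤ.+ (x + y) ℤ.+ ℤ.-1ℤ ℤ.* Y ≡⟨ cong (λ z → z ℤ.+ ℤ.-1ℤ ℤ.* Y) (ℤ.pos-+ x y) ⟩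
  (X ℤ.+ Y) ℤ.+ ℤ.-1ℤ ℤ.* Y   ≡⟨ solve 2 (λ X Y → (X :+ Y) :+ con ℤ.-1ℤ :* Y := X) refl X Y ⟩
  X                           ∎))
  where
  open ≡-Reasoning
  open +-*-Solver
  X = ℤ.+ x
  Y = ℤ.+ y

a b : Fin 7 → ℕ
a = lookup (4 ∷ 4 ∷ 6 ∷ 8 ∷ 8 ∷ 6 ∷ 6 ∷ [])
b = lookup (2 ∷ 3 ∷ 3 ∷ 0 ∷ 1 ∷ 2 ∷ 1 ∷ [])

a-b : Fin 7 → ℕ
a-b s = a s ∸ b s

digit : ℕ → Fin 7 → ℕ
digit m s = a s + m * b s

point : ∀ {n} → Vec (Fin 7) n → ℚ × ℚ
point w = ι (baseValue 16 a w) , ι (baseValue 16 b w)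

π-point : ∀ m {n} (w : Vec (Fin 7) n) → π (fin (ι m)) (point w) ≡ ι (baseValue 16 (digit m) w)
π-point m w = trans (π-ι m (baseValue 16 a w) (baseValue 16 b w)) (cong ι (sym (begin
  baseValue 16 (digit m) w                          ≡⟨ baseValue-+ 16 a (λ s → m * b s) w ⟩
  baseValue 16 a w + baseValue 16 (λ s → m * b s) w ≡⟨ cong (baseValue 16 a w +_) (baseValue-*ˡ 16 m b w) ⟩
  baseValue 16 a w + m * baseValue 16 b w           ∎)))
  where open ≡-Reasoning

π-1-point : ∀ {n} (w : Vec (Fin 7) n) → π (fin (- 1ℚ)) (point w) ≡ ι (baseValue 16 a-b w)
π-1-point w = trans (cong (λ x → π (fin (- 1ℚ)) (ι x , ι (baseValue 16 b w))) a≡a-b+b)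
  (π-1-ι (baseValue 16 a-b w) (baseValue 16 b w))
  where
  b≤a : ∀ s → b s ≤ a s
  b≤a = from-yes (all? λ s → b s ≤? a s)
  a≡a-b+b : baseValue 16 a w ≡ baseValue 16 a-b w + baseValue 16 b w
  a≡a-b+b = trans (baseValue-cong 16 (λ s → sym (m∸n+n≡m (b≤a s))) w) (baseValue-+ 16 a-b b w)

point-injective : ∀ {n} {w w′ : Vec (Fin 7) n} →
                  π (fin (- 1ℚ)) (point w) ≡ π (fin (- 1ℚ)) (point w′) → w ≡ w′
point-injective {w = w} {w′} eq = baseValue-injective 16 a-b
  (from-yes (all? λ s → a-b s <? 16))
  (λ {s} {s′} → from-yes (all? λ s → all? λ s′ → a-b s ≟ℕ a-b s′ →-dec s ≟ s′) s s′)
  w w′ (ι-injective (trans (sym (π-1-point w)) (trans eq (π-1-point w′))))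

projectedContent : ∀ {k} → (Fin k → ℕ) → Content k → Content 16
projectedContent v c = pushforward (λ s → v s mod 16) c

imageCard-baseValue-words : ∀ {k} n (v : Fin k → ℕ) → (∀ s → v s < 16) → (c : Content k) →
                            imageCard (ι ∘ baseValue 16 v) (words n c) ≤
                            length (words n (projectedContent v c))
imageCard-baseValue-words n v v<16 c = begin
  imageCard (ι ∘ baseValue 16 v) (words n c)      ≤⟨ imageCard-≤ (ι ∘ baseValue 16 v) readDigits ⟩
  length (map (ι ∘ baseValue 16 toℕ) (words n c′)) ≡⟨ length-map _ (words n c′) ⟩
  length (words n c′)                             ∎
  where
  open ≤-Reasoning
  f = λ s → v s mod 16
  c′ = projectedContent v c
  toℕ∘f≗v : ∀ s → toℕ (f s) ≡ v s
  toℕ∘f≗v s = trans (toℕ-fromℕ< (m%n<n (v s) 16)) (m<n⇒m%n≡m (v<16 s))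
  readDigits : ∀ {w} → w ∈ words n c →
               ι (baseValue 16 v w) ∈ map (ι ∘ baseValue 16 toℕ) (words n c′)
  readDigits {w} w∈ = subst (_∈ map (ι ∘ baseValue 16 toℕ) (words n c′))
    (cong ι (trans (baseValue-map 16 toℕ f w) (baseValue-cong 16 toℕ∘f≗v w)))
    (∈-map⁺ (ι ∘ baseValue 16 toℕ) (map-∈-words f n w∈))

-- Kept abstract in n and c: for the actual content G has more than 2⁴⁷³ elements, and a
-- conversion check that unfolds it would not terminate in practice.
module TypeClass (n : ℕ) (c : Content 7) (sum≡n : sum c ≡ n) where

  G : List (ℚ × ℚ)
  G = map point (words n c)

  G-unique : Unique G
  G-unique = Unique.map⁺ (λ eq → point-injective (cong (π (fin (- 1ℚ))) eq)) (words-unique n c)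

  G-injectiveOn : InjectiveOn (π (fin (- 1ℚ))) G
  G-injectiveOn x∈G y∈G eq with ∈-map⁻ point x∈G | ∈-map⁻ point y∈G
  ... | w , _ , refl | w′ , _ , refl = cong point (point-injective {w = w} {w′} eq)

  length-G-≥ : ∀ {B} → B * ∏! c ≤ n ! → B ≤ length G
  length-G-≥ bound =
    subst (_ ≤_) (sym (length-map point (words n c))) (length-words-≥ n c sum≡n bound)

  projCard-G-≤ : ∀ r (v : Fin 7 → ℕ) → (∀ (w : Vec (Fin 7) n) → π r (point w) ≡ ι (baseValue 16 v w)) →
                 (∀ s → v s < 16) → ∀ {B} → n ! ≤ B * ∏! (projectedContent v c) → projCard r G ≤ B
  projCard-G-≤ r v π-point≡ v<16 {B} bound = begin
    projCard r G                               ≡⟨ imageCard-map (π r) point (words n c) ⟩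
    imageCard (π r ∘ point) (words n c)        ≡⟨ imageCard-cong π-point≡ (words n c) ⟩
    imageCard (ι ∘ baseValue 16 v) (words n c) ≤⟨ imageCard-baseValue-words n v v<16 c ⟩
    length (words n (projectedContent v c))    ≤⟨ length-words-≤ n _ sum-projected bound ⟩
    B                                          ∎
    where
    open ≤-Reasoning
    sum-projected : sum (projectedContent v c) ≡ n
    sum-projected = trans (sum-pushforward (λ s → v s mod 16) c) sum≡n

  ProjectionsAtMost : ℕ → Set
  ProjectionsAtMost B = n ! ≤ B * ∏! (projectedContent (digit 0) c)
                      × n ! ≤ B * ∏! (projectedContent (digit 1) c)
                      × n ! ≤ B * ∏! (projectedContent (digit 2) c)
                      × n ! ≤ B * ∏! (projectedContent b c)

  maxProj-G-≤ : ∀ {B} → ProjectionsAtMost B → maxProj0-1-2-∞ G ≤ B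
  maxProj-G-≤ (bound₀ , bound₁ , bound₂ , bound∞) = ⊔-lub (⊔-lub (⊔-lub
    (projCard-G-≤ (fin 0ℚ) (digit 0) (π-point 0) (below16 (digit 0)) bound₀)
    (projCard-G-≤ (fin 1ℚ) (digit 1) (π-point 1) (below16 (digit 1)) bound₁))
    (projCard-G-≤ (fin (1ℚ ℚ.+ 1ℚ)) (digit 2) (π-point 2) (below16 (digit 2)) bound₂))
    (projCard-G-≤ ∞ b (λ _ → refl) (below16 b) bound∞)
    where
    below16 : (v : Fin 7 → ℕ) → From-yes (all? λ s → v s <? 16)
    below16 v = from-yes (all? λ s → v s <? 16)

  witness : ∀ p q → 2 ^ q * ∏! c ≤ n ! → ProjectionsAtMost (2 ^ p) → p * 161226 < q * 100000 →
            Σ (List (ℚ × ℚ)) λ G →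
              Unique G × InjectiveOn (π (fin (- 1ℚ))) G
              × 2 ≤ maxProj0-1-2-∞ G
              × maxProj0-1-2-∞ G ^ 161226 < length G ^ 100000
  witness p q 2^q*∏!≤n! projections≤2^p pa<qb =
    G , G-unique , G-injectiveOn , 2≤maxProj G-unique (≤-trans 2≤2^q 2^q≤|G|) ,
    ^-<-via-powers-of-2 {p = p} {q} {161226} {100000} (maxProj-G-≤ projections≤2^p) 2^q≤|G| pa<qb
    where
    2^q≤|G| : 2 ^ q ≤ length G
    2^q≤|G| = length-G-≥ 2^q*∏!≤n!
    positive : ∀ e → p * 161226 < e * 100000 → 1 ≤ e
    positive zero    ()
    positive (suc _) _ = s≤s z≤n
    2≤2^q : 2 ≤ 2 ^ q
    2≤2^q = ^-monoʳ-≤ 2 (positive q pa<qb)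

content : Content 7
content = lookup (7 ∷ 46 ∷ 38 ∷ 6 ∷ 40 ∷ 11 ∷ 52 ∷ [])

theorem2 : Σ (List (ℚ × ℚ)) λ G →
    Unique G × InjectiveOn (π (fin (- 1ℚ))) G
    × 2 ≤ maxProj0-1-2-∞ G
    × maxProj0-1-2-∞ G ^ 161226 < length G ^ 100000
theorem2 = TypeClass.witness 200 content refl 292 473
  (from-yes (2 ^ 473 * ∏! content ≤? 200 !))
  (projectionBound (digit 0) , projectionBound (digit 1) , projectionBound (digit 2) , projectionBound b)
  (from-yes (292 * 161226 <? 473 * 100000))
  where
  projectionBound : (v : Fin 7 → ℕ) → From-yes (200 ! ≤? 2 ^ 292 * ∏! (projectedContent v content))
  projectionBound v = from-yes (200 ! ≤? 2 ^ 292 * ∏! (projectedContent v content))
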